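{- Let $q$ be a prime power and $n,k$ integers with $n>2k\geq 6$. Let $X$ be the set of $k$-dimensional subspaces of an $n$-dimensional $\mathbb{F}_q$-vector space $V$, regarded as the vertex set of the Grassmann graph $J_q(n,k)$ with distance $\partial$, and pick $x,y\in X$ with $1<\partial(x,y)<k$. With $F^0,F^+,F^-$ as defined below, for $w\in\mathcal{A}_{xy}$ the following hold: (i) $(F^-F^+)_{w,x}=0$; (ii) if $w\in\mathcal{A}^+_{xy}$ then $(F^0F^-)_{w,x}=0$; (iii) if $w\in\mathcal{A}^+_{xy}$ then $(F^-F^0)_{w,x}=0$; (iv) if $w\in\mathcal{A}^+_{xy}$ then $((F^-)^2)_{w,x}=0$; (v) if $w\in\mathcal{A}^-_{xy}$ then $(F^0F^+)_{w,x}=0$; (vi) if $w\in\mathcal{A}^-_{xy}$ then $(F^+F^0)_{w,x}=0$; (vii) if $w\in\mathcal{A}^-_{xy}$ then $((F^+)^2)_{w,x}=0$.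
   Context: Vertices $u,v\in X$ are adjacent when $\dim(u\cap v)=k-1$; $\Gamma(x)$ is the set of neighbours of $x$, and $\mathcal{A}_{xy}=\{z\in\Gamma(x):\partial(z,y)=\partial(x,y)\}$. $P$ is the set of all subspaces of $V$ and matrices are in $\mathrm{Mat}_P(\mathbb{C})$. For $u\in P$ with $\dim(u\cap y)=a$, $\dim u=a+b$ write $u\in P_{a,b}$. If $u\subseteq v$, $\dim v=\dim u+1$, $u\in P_{a,b}$, then $v\in P_{a+1,b}$ ($v$ $/$-covers $u$) or $v\in P_{a,b+1}$ ($v$ $\backslash$-covers $u$). $(F^0)_{u,v}=1$ if $u+v$ $/$-covers each of $u,v$ and each of $u,v$ $\backslash$-covers $u\cap v$, else $0$; $(F^+)_{u,v}=1$ if $u+v$ $\backslash$-covers each of $u,v$, else $0$; $(F^-)_{u,v}=1$ if each of $u,v$ $/$-covers $u\cap v$, else $0$. $\mathcal{A}^+_{xy}=\{z\in\Gamma(x): z+x$ $\backslash$-covers each of $z,x\}$; $\mathcal{A}^-_{xy}=\{z\in\Gamma(x):$ each of $z,x$ $/$-covers $z\cap x\}$. -}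

module Defs where

open import Level using (0ℓ)
open import Data.Nat using (ℕ; zero; suc; _≤_; _∸_)
open import Data.Product using (Σ; ∃; ∃-syntax; _×_; _,_; proj₁)
open import Data.Empty using (⊥)
open import Data.List using (List)
open import Data.List.Membership.Propositional using (_∈_)
open import Data.Vec using (Vec; []; _∷_; zipWith; map; replicate)
open import Data.Vec.Relation.Unary.All using (All)
open import Relation.Binary.PropositionalEquality using (_≡_; _≢_)
open import Relation.Nullary using (¬_)

-- A finite field (the field F_q; q = number of elements, necessarily a
-- prime power).  Field axioms with propositional equality.

record FiniteField : Set₁ where
  infixl 6 _+_
  infixl 7 _*_
  field
    Carrier : Set
    _+_ _*_ : Carrier → Carrier → Carrier
    -_      : Carrier → Carrier
    0# 1#   : Carrier
    inv     : (a : Carrier) → a ≢ 0# → Carrier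
    +-assoc : ∀ a b c → (a + b) + c ≡ a + (b + c)
    +-comm  : ∀ a b → a + b ≡ b + a
    +-idˡ   : ∀ a → 0# + a ≡ a
    -‿invˡ  : ∀ a → (- a) + a ≡ 0#
    *-assoc : ∀ a b c → (a * b) * c ≡ a * (b * c)
    *-comm  : ∀ a b → a * b ≡ b * a
    *-idˡ   : ∀ a → 1# * a ≡ a
    distribˡ : ∀ a b c → a * (b + c) ≡ (a * b) + (a * c)
    inv-invˡ : ∀ a (a≢0 : a ≢ 0#) → inv a a≢0 * a ≡ 1#
    1≢0     : 1# ≢ 0#
    elements : List Carrier
    complete : ∀ a → a ∈ elements

module Grassmann (F : FiniteField) (n : ℕ) where
  open FiniteField F

  V : Set
  V = Vec Carrier n

  0v : V
  0v = replicate n 0#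

  _⊕_ : V → V → V
  _⊕_ = zipWith _+_

  _·_ : Carrier → V → V
  c · v = map (c *_) v

  lincomb : ∀ {d} → Vec V d → Vec Carrier d → V
  lincomb []       []       = 0v
  lincomb (b ∷ bs) (c ∷ cs) = (c · b) ⊕ lincomb bs cs

  Sub : Set₁
  Sub = V → Set

  record IsSubspace (S : Sub) : Set where
    field
      has-0 : S 0v
      ⊕-closed : ∀ a b → S a → S b → S (a ⊕ b)
      ·-closed : ∀ c a → S a → S (c · a)

  P : Set₁
  P = Σ Sub IsSubspace

  LinIndep : ∀ {d} → Vec V d → Set
  LinIndep bs = ∀ cs → lincomb bs cs ≡ 0v → cs ≡ replicate _ 0#

  Spans : ∀ {d} → Vec V d → Sub → Set
  Spans bs S = ∀ v → S v → ∃[ cs ] lincomb bs cs ≡ v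

  HasDim : Sub → ℕ → Set
  HasDim S d = Σ (Vec V d) λ bs → All S bs × LinIndep bs × Spans bs S

  _∩_ : Sub → Sub → Sub
  (u ∩ w) v = u v × w v

  _+ₛ_ : Sub → Sub → Sub
  (u +ₛ w) v = ∃[ a ] ∃[ b ] (u a × w b × (a ⊕ b) ≡ v)

  _⊆_ : Sub → Sub → Set
  u ⊆ w = ∀ v → u v → w v

  _≐_ : Sub → Sub → Set
  u ≐ w = u ⊆ w × w ⊆ u

  module Rel (y : Sub) where
    InP : Sub → ℕ → ℕ → Set
    InP u a b = HasDim (u ∩ y) a × HasDim u (a Data.Nat.+ b)

    SlashCovers : Sub → Sub → Set
    SlashCovers v u = u ⊆ v × ∃[ a ] ∃[ b ] (InP u a b × InP v (suc a) b)

    BackCovers : Sub → Sub → Set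
    BackCovers v u = u ⊆ v × ∃[ a ] ∃[ b ] (InP u a b × InP v a (suc b))

    -- the 0/1 matrices F⁰, F⁺, F⁻ ∈ Mat_P(ℂ), given by the relation
    -- "(F)_{u,v} = 1"; all other entries are 0.
    F⁰ : P → P → Set
    F⁰ (u , _) (v , _) =
      SlashCovers (u +ₛ v) u × SlashCovers (u +ₛ v) v
      × BackCovers u (u ∩ v) × BackCovers v (u ∩ v)

    F⁺ : P → P → Set
    F⁺ (u , _) (v , _) = BackCovers (u +ₛ v) u × BackCovers (u +ₛ v) v

    F⁻ : P → P → Set
    F⁻ (u , _) (v , _) = SlashCovers u (u ∩ v) × SlashCovers v (u ∩ v)

  -- For 0/1 matrices A, B (non-negative entries) indexed by P,
  -- (AB)_{w,x} = Σ_{u ∈ P} A_{w,u} B_{u,x} = 0  iff no term is nonzero.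
  ProdEntryZero : (P → P → Set) → (P → P → Set) → P → P → Set₁
  ProdEntryZero A B w x = ∀ (u : P) → A w u → B u x → ⊥

  module Graph (k : ℕ) where
    IsVertex : P → Set
    IsVertex (u , _) = HasDim u k

    Adj : P → P → Set
    Adj (u , _) (v , _) = HasDim (u ∩ v) (k ∸ 1)

    data Walk : P → P → ℕ → Set₁ where
      here : ∀ {u v} → IsVertex u → proj₁ u ≐ proj₁ v → Walk u v 0
      step : ∀ {u w v m} → IsVertex u → Adj u w → Walk w v m → Walk u v (suc m)

    Dist : P → P → ℕ → Set₁
    Dist u v d = Walk u v d × (∀ m → Walk u v m → d ≤ m)

    Γ : P → P → Set
    Γ x w = IsVertex w × Adj x w

    𝒜 : P → P → P → Set₁
    𝒜 x y w = Γ x w × ∃[ d ] (Dist w y d × Dist x y d)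

    𝒜⁺ : P → P → P → Set
    𝒜⁺ x y w = Γ x w × (BackCovers (proj₁ w +ₛ proj₁ x) (proj₁ w)
                        × BackCovers (proj₁ w +ₛ proj₁ x) (proj₁ x))
      where open Rel (proj₁ y)

    𝒜⁻ : P → P → P → Set
    𝒜⁻ x y w = Γ x w × (SlashCovers (proj₁ w) (proj₁ w ∩ proj₁ x)
                        × SlashCovers (proj₁ x) (proj₁ w ∩ proj₁ x))
      where open Rel (proj₁ y)

-- Relative to y, a \-cover v of u adds nothing of y (v ∩ y ⊆ u, the two
-- intersections having equal dimension), while a /-cover does (v ∩ y ⊈ u).
-- A nonzero term of any of the seven products yields a chain of \-covers
-- showing that some /-cover in the hypotheses adds nothing of y.  For (i) and
-- (iv) one first asks whether w ∩ u ⊆ x: if not, an element of w ∩ u outside x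
-- together with the hyperplane x ∩ w of w (resp. u ∩ x of u) spans w (resp. u),
-- which puts it inside u + x (resp. w + x); if so, w ∩ u = x ∩ w, both being
-- hyperplanes of w.
module Submission where

open import Defs
open import Data.Nat using (ℕ; zero; suc; _<_; _≤_; _*_; z≤n; s≤s; _≤?_)
import Data.Nat.Properties as ℕ
open import Data.Product using (Σ; ∃; ∃-syntax; _×_; _,_; proj₁; proj₂)
import Data.Product as Product
open import Level using (0ℓ)
open import Function using (_∘_)
open import Data.Fin using (Fin; zero; suc)
open import Data.Vec
  using (Vec; []; _∷_; map; replicate; lookup; head; tail; insertAt; removeAt)
open import Data.Vec.Properties
  using (zipWith-assoc; zipWith-comm; zipWith-identityˡ; lookup-map; insertAt-lookup; removeAt-insertAt)
open import Data.Vec.Relation.Unary.All using (All; []; _∷_)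
import Data.Vec.Relation.Unary.All as All
open import Data.Sum using (_⊎_; inj₁; inj₂)
open import Data.Empty using (⊥-elim)
open import Relation.Nullary using (¬_; yes; no)
open import Relation.Nullary.Decidable using (¬¬-excluded-middle; decidable-stable)
open import Relation.Nullary.Negation using (¬¬-Monad)
open import Effect.Monad using (RawMonad)
open import Relation.Binary.PropositionalEquality

open RawMonad (¬¬-Monad {a = 0ℓ}) using (pure; _>>=_; _<$>_)

¬¬-All : ∀ {A : Set} {P : A → Set} {m} {xs : Vec A m} → All (λ x → ¬ ¬ P x) xs → ¬ ¬ All P xs
¬¬-All []       = pure []
¬¬-All (p ∷ ps) = do
  a  ← p
  as ← ¬¬-All ps
  pure (a ∷ as)

removeAt-replicate : ∀ {A : Set} {m} (i : Fin (suc m)) (a : A) →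
                     removeAt (replicate (suc m) a) i ≡ replicate m a
removeAt-replicate {m = zero}  zero    a = refl
removeAt-replicate {m = suc m} zero    a = refl
removeAt-replicate {m = suc m} (suc i) a = cong (a ∷_) (removeAt-replicate i a)

module FieldProperties (F : FiniteField) where
  open FiniteField F renaming (_*_ to _⋆_)
  open ≡-Reasoning

  *-identityʳ : ∀ a → a ⋆ 1# ≡ a
  *-identityʳ a = trans (*-comm a 1#) (*-idˡ a)

  distribʳ : ∀ a b c → (a + b) ⋆ c ≡ a ⋆ c + b ⋆ c
  distribʳ a b c = begin
    (a + b) ⋆ c     ≡⟨ *-comm (a + b) c ⟩
    c ⋆ (a + b)     ≡⟨ distribˡ c a b ⟩
    c ⋆ a + c ⋆ b   ≡⟨ cong₂ _+_ (*-comm c a) (*-comm c b) ⟩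
    a ⋆ c + b ⋆ c   ∎

  a≡a+a⇒a≡0 : ∀ a → a ≡ a + a → a ≡ 0#
  a≡a+a⇒a≡0 a a≡a+a = begin
    a                 ≡⟨ sym (+-idˡ a) ⟩
    0# + a            ≡⟨ cong (_+ a) (sym (-‿invˡ a)) ⟩
    (- a) + a + a     ≡⟨ +-assoc (- a) a a ⟩
    (- a) + (a + a)   ≡⟨ cong ((- a) +_) (sym a≡a+a) ⟩
    (- a) + a         ≡⟨ -‿invˡ a ⟩
    0#                ∎

  zeroˡ : ∀ a → 0# ⋆ a ≡ 0#
  zeroˡ a = a≡a+a⇒a≡0 (0# ⋆ a) (trans (cong (_⋆ a) (sym (+-idˡ 0#))) (distribʳ 0# 0# a))

  zeroʳ : ∀ a → a ⋆ 0# ≡ 0#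
  zeroʳ a = trans (*-comm a 0#) (zeroˡ a)

  -1⋆a+a≡0 : ∀ a → (- 1#) ⋆ a + a ≡ 0#
  -1⋆a+a≡0 a = begin
    (- 1#) ⋆ a + a         ≡⟨ cong ((- 1#) ⋆ a +_) (sym (*-idˡ a)) ⟩
    (- 1#) ⋆ a + 1# ⋆ a    ≡⟨ sym (distribʳ (- 1#) 1# a) ⟩
    ((- 1#) + 1#) ⋆ a      ≡⟨ cong (_⋆ a) (-‿invˡ 1#) ⟩
    0# ⋆ a                 ≡⟨ zeroˡ a ⟩
    0#                     ∎

module VectorProperties (F : FiniteField) where
  open FiniteField F renaming (_*_ to _⋆_)
  open FieldProperties F
  open ≡-Reasoning

  module Fᵈ {d : ℕ} = Grassmann F d
  open Fᵈ public using (_⊕_; _·_; 0v; lincomb)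

  private
    C = Carrier
    variable
      d m : ℕ

  ⊕-assoc : (a b c : Vec C d) → (a ⊕ b) ⊕ c ≡ a ⊕ (b ⊕ c)
  ⊕-assoc = zipWith-assoc +-assoc

  ⊕-comm : (a b : Vec C d) → a ⊕ b ≡ b ⊕ a
  ⊕-comm = zipWith-comm +-comm

  ⊕-identityˡ : (a : Vec C d) → 0v ⊕ a ≡ a
  ⊕-identityˡ = zipWith-identityˡ +-idˡ

  ⊕-identityʳ : (a : Vec C d) → a ⊕ 0v ≡ a
  ⊕-identityʳ a = trans (⊕-comm a 0v) (⊕-identityˡ a)

  ⊕-swap : (a b c : Vec C d) → a ⊕ (b ⊕ c) ≡ b ⊕ (a ⊕ c)
  ⊕-swap a b c = trans (sym (⊕-assoc a b c)) (trans (cong (_⊕ c) (⊕-comm a b)) (⊕-assoc b a c))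

  ⊕-interchange : (a b c e : Vec C d) → (a ⊕ b) ⊕ (c ⊕ e) ≡ (a ⊕ c) ⊕ (b ⊕ e)
  ⊕-interchange a b c e = begin
    (a ⊕ b) ⊕ (c ⊕ e)   ≡⟨ ⊕-assoc a b (c ⊕ e) ⟩
    a ⊕ (b ⊕ (c ⊕ e))   ≡⟨ cong (a ⊕_) (sym (⊕-assoc b c e)) ⟩
    a ⊕ ((b ⊕ c) ⊕ e)   ≡⟨ cong (λ z → a ⊕ (z ⊕ e)) (⊕-comm b c) ⟩
    a ⊕ ((c ⊕ b) ⊕ e)   ≡⟨ cong (a ⊕_) (⊕-assoc c b e) ⟩
    a ⊕ (c ⊕ (b ⊕ e))   ≡⟨ sym (⊕-assoc a c (b ⊕ e)) ⟩
    (a ⊕ c) ⊕ (b ⊕ e)   ∎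

  ·-distribˡ : ∀ c (a b : Vec C d) → c · (a ⊕ b) ≡ (c · a) ⊕ (c · b)
  ·-distribˡ c []      []      = refl
  ·-distribˡ c (x ∷ a) (y ∷ b) = cong₂ _∷_ (distribˡ c x y) (·-distribˡ c a b)

  ·-distribʳ : ∀ c e (a : Vec C d) → (c + e) · a ≡ (c · a) ⊕ (e · a)
  ·-distribʳ c e []      = refl
  ·-distribʳ c e (x ∷ a) = cong₂ _∷_ (distribʳ c e x) (·-distribʳ c e a)

  ·-assoc : ∀ c e (a : Vec C d) → (c ⋆ e) · a ≡ c · (e · a)
  ·-assoc c e []      = refl
  ·-assoc c e (x ∷ a) = cong₂ _∷_ (*-assoc c e x) (·-assoc c e a)

  ·-identityˡ : (a : Vec C d) → 1# · a ≡ a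
  ·-identityˡ []      = refl
  ·-identityˡ (x ∷ a) = cong₂ _∷_ (*-idˡ x) (·-identityˡ a)

  ·-zeroˡ : (a : Vec C d) → 0# · a ≡ 0v
  ·-zeroˡ []      = refl
  ·-zeroˡ (x ∷ a) = cong₂ _∷_ (zeroˡ x) (·-zeroˡ a)

  ·-zeroʳ : ∀ c → c · 0v {d} ≡ 0v
  ·-zeroʳ {zero}  c = refl
  ·-zeroʳ {suc d} c = cong₂ _∷_ (zeroʳ c) (·-zeroʳ c)

  -1·a⊕a≡0 : (a : Vec C d) → ((- 1#) · a) ⊕ a ≡ 0v
  -1·a⊕a≡0 []      = refl
  -1·a⊕a≡0 (x ∷ a) = cong₂ _∷_ (-1⋆a+a≡0 x) (-1·a⊕a≡0 a)

  a⊕b≡0⇒a≡-1·b : (a b : Vec C d) → a ⊕ b ≡ 0v → a ≡ (- 1#) · b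
  a⊕b≡0⇒a≡-1·b a b a⊕b≡0 = begin
    a                           ≡⟨ sym (⊕-identityʳ a) ⟩
    a ⊕ 0v                      ≡⟨ cong (a ⊕_) (sym (trans (⊕-comm b _) (-1·a⊕a≡0 b))) ⟩
    a ⊕ (b ⊕ ((- 1#) · b))      ≡⟨ sym (⊕-assoc a b _) ⟩
    (a ⊕ b) ⊕ ((- 1#) · b)      ≡⟨ cong (_⊕ ((- 1#) · b)) a⊕b≡0 ⟩
    0v ⊕ ((- 1#) · b)           ≡⟨ ⊕-identityˡ _ ⟩
    (- 1#) · b                  ∎

  lincomb-zero : (bs : Vec (Vec C d) m) → lincomb bs 0v ≡ 0v
  lincomb-zero []       = refl
  lincomb-zero (b ∷ bs) = trans (cong₂ _⊕_ (·-zeroˡ b) (lincomb-zero bs)) (⊕-identityˡ 0v)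

  lincomb-⊕ : (bs : Vec (Vec C d) m) (u v : Vec C m) →
              lincomb bs (u ⊕ v) ≡ lincomb bs u ⊕ lincomb bs v
  lincomb-⊕ []       []      []      = sym (⊕-identityˡ 0v)
  lincomb-⊕ (b ∷ bs) (x ∷ u) (y ∷ v) = begin
    ((x + y) · b) ⊕ lincomb bs (u ⊕ v)
      ≡⟨ cong₂ _⊕_ (·-distribʳ x y b) (lincomb-⊕ bs u v) ⟩
    ((x · b) ⊕ (y · b)) ⊕ (lincomb bs u ⊕ lincomb bs v)
      ≡⟨ ⊕-interchange _ _ _ _ ⟩
    ((x · b) ⊕ lincomb bs u) ⊕ ((y · b) ⊕ lincomb bs v)
      ∎

  lincomb-· : (bs : Vec (Vec C d) m) (c : C) (u : Vec C m) →
              lincomb bs (c · u) ≡ c · lincomb bs u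
  lincomb-· []       c []      = sym (·-zeroʳ c)
  lincomb-· (b ∷ bs) c (x ∷ u) = begin
    ((c ⋆ x) · b) ⊕ lincomb bs (c · u)   ≡⟨ cong₂ _⊕_ (·-assoc c x b) (lincomb-· bs c u) ⟩
    (c · (x · b)) ⊕ (c · lincomb bs u)   ≡⟨ sym (·-distribˡ c _ _) ⟩
    c · ((x · b) ⊕ lincomb bs u)         ∎

  lincomb-lincomb : ∀ {n} (bs : Vec (Vec C n) d) (cs : Vec (Vec C d) m) (es : Vec C m) →
                    lincomb bs (lincomb cs es) ≡ lincomb (map (lincomb bs) cs) es
  lincomb-lincomb bs []       []       = lincomb-zero bs
  lincomb-lincomb bs (c ∷ cs) (e ∷ es) = begin
    lincomb bs ((e · c) ⊕ lincomb cs es)             ≡⟨ lincomb-⊕ bs _ _ ⟩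
    lincomb bs (e · c) ⊕ lincomb bs (lincomb cs es)  ≡⟨ cong₂ _⊕_ (lincomb-· bs e c) (lincomb-lincomb bs cs es) ⟩
    (e · lincomb bs c) ⊕ lincomb (map (lincomb bs) cs) es ∎

module Elimination (F : FiniteField) where
  open FiniteField F renaming (_*_ to _⋆_)
  open FieldProperties F
  open VectorProperties F
  open ≡-Reasoning

  private
    C = Carrier
    variable
      A : Set
      d m : ℕ

  -- Linear independence in the double-negation-stable form that classical
  -- case distinctions (on whether a scalar is 0) can establish.
  ¬¬LinIndep : Vec (Vec C d) m → Set
  ¬¬LinIndep as = ∀ cs → lincomb as cs ≡ 0v → ¬ ¬ (cs ≡ 0v)

  dot : Vec C m → Vec C m → C
  dot []       []       = 0#
  dot (c ∷ cs) (h ∷ hs) = c ⋆ h + dot cs hs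

  head∷tail : (a : Vec A (suc d)) → head a ∷ tail a ≡ a
  head∷tail (x ∷ a) = refl

  lincomb-head-tail : (as : Vec (Vec C (suc d)) m) (cs : Vec C m) →
                      lincomb as cs ≡ dot cs (map head as) ∷ lincomb (map tail as) cs
  lincomb-head-tail []       []       = refl
  lincomb-head-tail ((h ∷ t) ∷ as) (c ∷ cs) = cong ((c · (h ∷ t)) ⊕_) (lincomb-head-tail as cs)

  dot-zeroʳ : (cs hs : Vec C m) → All (_≡ 0#) hs → dot cs hs ≡ 0#
  dot-zeroʳ []       []       []            = refl
  dot-zeroʳ (c ∷ cs) (h ∷ hs) (h≡0 ∷ hs≡0) = begin
    c ⋆ h + dot cs hs  ≡⟨ cong₂ _+_ (trans (cong (c ⋆_) h≡0) (zeroʳ c)) (dot-zeroʳ cs hs hs≡0) ⟩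
    0# + 0#            ≡⟨ +-idˡ 0# ⟩
    0#                 ∎

  dot-map-scale : ∀ κ (f : A → C) (cs : Vec C m) (xs : Vec A m) →
                  dot cs (map (λ x → κ ⋆ f x) xs) ≡ κ ⋆ dot cs (map f xs)
  dot-map-scale κ f []       []       = sym (zeroʳ κ)
  dot-map-scale κ f (c ∷ cs) (x ∷ xs) = begin
    c ⋆ (κ ⋆ f x) + dot cs (map (λ x → κ ⋆ f x) xs)  ≡⟨ cong₂ _+_ swap (dot-map-scale κ f cs xs) ⟩
    κ ⋆ (c ⋆ f x) + κ ⋆ dot cs (map f xs)             ≡⟨ sym (distribˡ κ _ _) ⟩
    κ ⋆ (c ⋆ f x + dot cs (map f xs))                 ∎
    where
    swap : c ⋆ (κ ⋆ f x) ≡ κ ⋆ (c ⋆ f x)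
    swap = trans (sym (*-assoc c κ (f x))) (trans (cong (_⋆ f x) (*-comm c κ)) (*-assoc κ c (f x)))

  lincomb-shear : (t : A → Vec C d) (g : A → C) (z : Vec C d) (xs : Vec A m) (cs : Vec C m) →
                  lincomb (map (λ x → t x ⊕ (g x · z)) xs) cs ≡ lincomb (map t xs) cs ⊕ (dot cs (map g xs) · z)
  lincomb-shear t g z []       []       = sym (trans (cong (0v ⊕_) (·-zeroˡ z)) (⊕-identityˡ 0v))
  lincomb-shear t g z (x ∷ xs) (c ∷ cs) = begin
    (c · (t x ⊕ (g x · z))) ⊕ lincomb (map (λ x → t x ⊕ (g x · z)) xs) cs
      ≡⟨ cong₂ _⊕_ (trans (·-distribˡ c (t x) _) (cong ((c · t x) ⊕_) (sym (·-assoc c (g x) z))))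
                   (lincomb-shear t g z xs cs) ⟩
    ((c · t x) ⊕ ((c ⋆ g x) · z)) ⊕ (lincomb (map t xs) cs ⊕ (dot cs (map g xs) · z))
      ≡⟨ ⊕-interchange _ _ _ _ ⟩
    ((c · t x) ⊕ lincomb (map t xs) cs) ⊕ (((c ⋆ g x) · z) ⊕ (dot cs (map g xs) · z))
      ≡⟨ cong (((c · t x) ⊕ lincomb (map t xs) cs) ⊕_) (sym (·-distribʳ _ _ z)) ⟩
    ((c · t x) ⊕ lincomb (map t xs) cs) ⊕ ((c ⋆ g x + dot cs (map g xs)) · z)
      ∎

  lincomb-removeAt : (as : Vec (Vec C d) (suc m)) (cs : Vec C (suc m)) (p : Fin (suc m)) →
                     lincomb as cs ≡ (lookup cs p · lookup as p) ⊕ lincomb (removeAt as p) (removeAt cs p)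
  lincomb-removeAt (a ∷ as)     (c ∷ cs)      zero    = refl
  lincomb-removeAt (a ∷ b ∷ as) (c ∷ c′ ∷ cs) (suc p) =
    trans (cong ((c · a) ⊕_) (lincomb-removeAt (b ∷ as) (c′ ∷ cs) p)) (⊕-swap _ _ _)

  allZero-or-nonzero : (hs : Vec C m) → ¬ ¬ (All (_≡ 0#) hs ⊎ ∃ λ p → lookup hs p ≢ 0#)
  allZero-or-nonzero []       = pure (inj₁ [])
  allZero-or-nonzero (h ∷ hs) = do
    yes h≡0 ← ¬¬-excluded-middle
      where no h≢0 → pure (inj₂ (zero , h≢0))
    inj₁ hs≡0 ← allZero-or-nonzero hs
      where inj₂ (p , hp≢0) → pure (inj₂ (suc p , hp≢0))
    pure (inj₁ (h≡0 ∷ hs≡0))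

  ¬¬LinIndep-tail : (as : Vec (Vec C (suc d)) m) → All (_≡ 0#) (map head as) →
                    ¬¬LinIndep as → ¬¬LinIndep (map tail as)
  ¬¬LinIndep-tail as heads≡0 ind cs tails≡0 = ind cs (begin
    lincomb as cs                                     ≡⟨ lincomb-head-tail as cs ⟩
    dot cs (map head as) ∷ lincomb (map tail as) cs   ≡⟨ cong₂ _∷_ (dot-zeroʳ cs _ heads≡0) tails≡0 ⟩
    0v                                                ∎)

  module Pivot {d m} (as : Vec (Vec C (suc d)) (suc m)) (p : Fin (suc m))
               (h≢0 : head (lookup as p) ≢ 0#) where
    pivot : Vec C (suc d)
    pivot = lookup as p

    κ : C
    κ = (- 1#) ⋆ inv (head pivot) h≢0

    rest : Vec (Vec C (suc d)) m
    rest = removeAt as p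

    reduced : Vec (Vec C d) m
    reduced = map (λ a → tail a ⊕ ((κ ⋆ head a) · tail pivot)) rest

    κ⋆a⋆pivot+a≡0 : ∀ a → (κ ⋆ a) ⋆ head pivot + a ≡ 0#
    κ⋆a⋆pivot+a≡0 a = trans (cong (_+ a) κ⋆a⋆pivot≡-1⋆a) (-1⋆a+a≡0 a)
      where
      h = head pivot
      κ⋆a⋆pivot≡-1⋆a : (κ ⋆ a) ⋆ h ≡ (- 1#) ⋆ a
      κ⋆a⋆pivot≡-1⋆a = begin
        (κ ⋆ a) ⋆ h                  ≡⟨ *-assoc κ a h ⟩
        κ ⋆ (a ⋆ h)                  ≡⟨ cong (κ ⋆_) (*-comm a h) ⟩
        κ ⋆ (h ⋆ a)                  ≡⟨ sym (*-assoc κ h a) ⟩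
        ((- 1#) ⋆ inv h h≢0 ⋆ h) ⋆ a ≡⟨ cong (_⋆ a) (*-assoc (- 1#) (inv h h≢0) h) ⟩
        ((- 1#) ⋆ (inv h h≢0 ⋆ h)) ⋆ a ≡⟨ cong (λ z → ((- 1#) ⋆ z) ⋆ a) (inv-invˡ h h≢0) ⟩
        ((- 1#) ⋆ 1#) ⋆ a            ≡⟨ cong (_⋆ a) (*-identityʳ (- 1#)) ⟩
        (- 1#) ⋆ a                   ∎

    ¬¬LinIndep-reduced : ¬¬LinIndep as → ¬¬LinIndep reduced
    ¬¬LinIndep-reduced ind cs reduced≡0 = do
      E≡0 ← ind E lincomb-as-E≡0
      pure (begin
        cs               ≡⟨ sym (removeAt-insertAt cs p c₀) ⟩
        removeAt E p     ≡⟨ cong (λ es → removeAt es p) E≡0 ⟩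
        removeAt 0v p    ≡⟨ removeAt-replicate p 0# ⟩
        0v               ∎)
      where
      D = dot cs (map head rest)
      L = lincomb (map tail rest) cs
      -- the coefficient of the pivot that cancels the first coordinate
      c₀ = κ ⋆ D
      E = insertAt cs p c₀

      tail-cancels : (c₀ · tail pivot) ⊕ L ≡ 0v
      tail-cancels = begin
        (c₀ · tail pivot) ⊕ L
          ≡⟨ ⊕-comm _ L ⟩
        L ⊕ (c₀ · tail pivot)
          ≡⟨ cong (λ z → L ⊕ (z · tail pivot)) (sym (dot-map-scale κ head cs rest)) ⟩
        L ⊕ (dot cs (map (λ a → κ ⋆ head a) rest) · tail pivot)
          ≡⟨ sym (lincomb-shear tail (λ a → κ ⋆ head a) (tail pivot) rest cs) ⟩
        lincomb reduced cs
          ≡⟨ reduced≡0 ⟩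
        0v ∎

      lincomb-as-E≡0 : lincomb as E ≡ 0v
      lincomb-as-E≡0 = begin
        lincomb as E
          ≡⟨ lincomb-removeAt as E p ⟩
        (lookup E p · pivot) ⊕ lincomb rest (removeAt E p)
          ≡⟨ cong₂ (λ c es → (c · pivot) ⊕ lincomb rest es) (insertAt-lookup cs p c₀) (removeAt-insertAt cs p c₀) ⟩
        (c₀ · pivot) ⊕ lincomb rest cs
          ≡⟨ cong₂ (λ a b → (c₀ · a) ⊕ b) (sym (head∷tail pivot)) (lincomb-head-tail rest cs) ⟩
        (c₀ ⋆ head pivot + D) ∷ ((c₀ · tail pivot) ⊕ L)
          ≡⟨ cong₂ _∷_ (κ⋆a⋆pivot+a≡0 D) tail-cancels ⟩
        0v ∎

  ¬¬LinIndep⇒length≤dim : ∀ d {m} (as : Vec (Vec C d) m) → ¬¬LinIndep as → ¬ ¬ (m ≤ d)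
  ¬¬LinIndep⇒length≤dim zero    []       ind = pure z≤n
  ¬¬LinIndep⇒length≤dim zero    (a ∷ as) ind =
    λ _ → ind (1# ∷ 0v) (Vec₀≡0v (lincomb (a ∷ as) (1# ∷ 0v))) (1≢0 ∘ cong head)
    where
    Vec₀≡0v : (v : Vec C 0) → v ≡ 0v
    Vec₀≡0v [] = refl
  ¬¬LinIndep⇒length≤dim (suc d) []       ind = pure z≤n
  ¬¬LinIndep⇒length≤dim (suc d) as@(_ ∷ _) ind = do
    inj₂ (p , hp≢0) ← allZero-or-nonzero (map head as)
      where inj₁ heads≡0 → ℕ.m≤n⇒m≤1+n <$> ¬¬LinIndep⇒length≤dim d (map tail as) (¬¬LinIndep-tail as heads≡0 ind)
    let open Pivot as p (hp≢0 ∘ trans (lookup-map p head as))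
    s≤s <$> ¬¬LinIndep⇒length≤dim d reduced (¬¬LinIndep-reduced ind)

module Dimension (F : FiniteField) (n : ℕ) where
  open FiniteField F using (Carrier; 0#; 1#; -_; inv; inv-invˡ) renaming (_*_ to _⋆_)
  open Grassmann F n
  open VectorProperties F
    using (module Fᵈ; ⊕-identityˡ; ⊕-identityʳ; ⊕-interchange; ·-distribˡ; ·-zeroˡ; ·-assoc; ·-identityˡ;
           a⊕b≡0⇒a≡-1·b; lincomb-zero; lincomb-lincomb)
  open Elimination F using (¬¬LinIndep; ¬¬LinIndep⇒length≤dim)
  open ≡-Reasoning

  private
    variable
      d m : ℕ
      R S T A B : Sub

  -- Inclusion up to double negation: membership in a subspace is not
  -- decidable, but every conclusion drawn from these inclusions is ⊥.
  _⊑_ : Sub → Sub → Set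
  S ⊑ T = ∀ v → S v → ¬ ¬ T v

  ∩-isSubspace : IsSubspace A → IsSubspace B → IsSubspace (A ∩ B)
  ∩-isSubspace sA sB = record
    { has-0    = A.has-0 , B.has-0
    ; ⊕-closed = λ a b (a∈A , a∈B) (b∈A , b∈B) → A.⊕-closed a b a∈A b∈A , B.⊕-closed a b a∈B b∈B
    ; ·-closed = λ c a (a∈A , a∈B) → A.·-closed c a a∈A , B.·-closed c a a∈B
    }
    where module A = IsSubspace sA
          module B = IsSubspace sB

  +ₛ-isSubspace : IsSubspace A → IsSubspace B → IsSubspace (A +ₛ B)
  +ₛ-isSubspace sA sB = record
    { has-0    = 0v , 0v , A.has-0 , B.has-0 , ⊕-identityˡ 0v
    ; ⊕-closed = λ { _ _ (a , b , a∈A , b∈B , refl) (a′ , b′ , a′∈A , b′∈B , refl) →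
                   a ⊕ a′ , b ⊕ b′ , A.⊕-closed a a′ a∈A a′∈A , B.⊕-closed b b′ b∈B b′∈B ,
                   ⊕-interchange a a′ b b′ }
    ; ·-closed = λ { c _ (a , b , a∈A , b∈B , refl) →
                   c · a , c · b , A.·-closed c a a∈A , B.·-closed c b b∈B , sym (·-distribˡ c a b) }
    }
    where module A = IsSubspace sA
          module B = IsSubspace sB

  +ₛ-inl : ∀ {v} → IsSubspace B → A v → (A +ₛ B) v
  +ₛ-inl {v = v} sB a = v , 0v , a , IsSubspace.has-0 sB , ⊕-identityʳ v

  +ₛ-inr : ∀ {v} → IsSubspace A → B v → (A +ₛ B) v
  +ₛ-inr {v = v} sA b = 0v , v , IsSubspace.has-0 sA , b , ⊕-identityˡ v

  +ₛ-least : IsSubspace R → A ⊑ R → B ⊑ R → (A +ₛ B) ⊑ R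
  +ₛ-least sR A⊑R B⊑R _ (a , b , a∈A , b∈B , refl) = do
    a∈R ← A⊑R a a∈A
    b∈R ← B⊑R b b∈B
    pure (IsSubspace.⊕-closed sR a b a∈R b∈R)

  lincomb-closed : IsSubspace S → {bs : Vec V m} → All S bs → ∀ cs → S (lincomb bs cs)
  lincomb-closed sS []               []       = IsSubspace.has-0 sS
  lincomb-closed sS {b ∷ _} (b∈S ∷ bs∈S) (c ∷ cs) =
    IsSubspace.⊕-closed sS _ _ (IsSubspace.·-closed sS c b b∈S) (lincomb-closed sS bs∈S cs)

  LinIndep⇒¬¬LinIndep : (bs : Vec V m) → LinIndep bs → ¬¬LinIndep bs
  LinIndep⇒¬¬LinIndep bs li cs e = pure (li cs e)

  ¬¬LinIndep-∷ : ∀ {t} {bs : Vec V m} → IsSubspace R → All R bs → ¬¬LinIndep bs → ¬ R t →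
                 ¬¬LinIndep (t ∷ bs)
  ¬¬LinIndep-∷ {R = R} {t = t} {bs} sR bs∈R ind t∉R (α ∷ cs) αt+L≡0 = do
    yes α≡0 ← ¬¬-excluded-middle
      where no α≢0 → ⊥-elim (t∉R (subst R (sym (t≡ α≢0)) L-multiple∈R))
    cs≡0 ← ind cs (L≡0 α≡0)
    pure (cong₂ _∷_ α≡0 cs≡0)
    where
    L = lincomb bs cs

    L≡0 : α ≡ 0# → L ≡ 0v
    L≡0 α≡0 = begin
      L              ≡⟨ sym (⊕-identityˡ L) ⟩
      0v ⊕ L         ≡⟨ cong (_⊕ L) (sym (·-zeroˡ t)) ⟩
      (0# · t) ⊕ L   ≡⟨ cong (λ c → (c · t) ⊕ L) (sym α≡0) ⟩
      (α · t) ⊕ L    ≡⟨ αt+L≡0 ⟩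
      0v             ∎

    t≡ : (α≢0 : α ≢ 0#) → t ≡ inv α α≢0 · ((- 1#) · L)
    t≡ α≢0 = begin
      t                                          ≡⟨ sym (·-identityˡ t) ⟩
      1# · t                                     ≡⟨ cong (_· t) (sym (inv-invˡ α α≢0)) ⟩
      (inv α α≢0 ⋆ α) · t                        ≡⟨ ·-assoc _ _ t ⟩
      inv α α≢0 · (α · t)                        ≡⟨ cong (inv α α≢0 ·_) (a⊕b≡0⇒a≡-1·b _ _ αt+L≡0) ⟩
      inv α α≢0 · ((- 1#) · L)                   ∎

    L-multiple∈R : ∀ {c} → R (c · ((- 1#) · L))
    L-multiple∈R = IsSubspace.·-closed sR _ _ (IsSubspace.·-closed sR _ _ (lincomb-closed sR bs∈R cs))

  coordinates : (bs : Vec V d) → Spans bs T → (as : Vec V m) → All T as →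
                Σ (Vec (Vec Carrier d) m) λ cs → map (lincomb bs) cs ≡ as
  coordinates bs spans []       []           = [] , refl
  coordinates bs spans (a ∷ as) (a∈T ∷ as∈T) =
    Product.zip _∷_ (cong₂ _∷_) (spans a a∈T) (coordinates bs spans as as∈T)

  ¬¬LinIndep⇒≤dim : (as : Vec V m) → ¬¬LinIndep as → All (λ v → ¬ ¬ T v) as → HasDim T d → m ≤ d
  ¬¬LinIndep⇒≤dim {m} {d = d} as ind as⊑T (bs , _ , _ , spans) = decidable-stable (m ≤? d) (do
    as∈T ← ¬¬-All as⊑T
    let (cs , bs·cs≡as) = coordinates bs spans as as∈T
    ¬¬LinIndep⇒length≤dim d cs λ es cs·es≡0 → ind es (begin
      lincomb as es                      ≡⟨ cong (λ z → lincomb z es) (sym bs·cs≡as) ⟩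
      lincomb (map (lincomb bs) cs) es   ≡⟨ sym (lincomb-lincomb bs cs es) ⟩
      lincomb bs (Fᵈ.lincomb cs es)      ≡⟨ cong (lincomb bs) cs·es≡0 ⟩
      lincomb bs Fᵈ.0v                   ≡⟨ lincomb-zero bs ⟩
      0v                                 ∎))

  dim-mono : ∀ {a b} → S ⊑ T → HasDim S a → HasDim T b → a ≤ b
  dim-mono S⊑T (bs , bs∈S , li , _) hT =
    ¬¬LinIndep⇒≤dim bs (LinIndep⇒¬¬LinIndep bs li) (All.map (S⊑T _) bs∈S) hT

  dim-unique : ∀ {a b} → HasDim S a → HasDim S b → a ≡ b
  dim-unique hS hS′ = ℕ.≤-antisym (dim-mono (λ _ → pure) hS hS′) (dim-mono (λ _ → pure) hS′ hS)

  ⊑-dim≡⇒⊒ : IsSubspace S → S ⊑ T → HasDim S d → HasDim T d → T ⊑ S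
  ⊑-dim≡⇒⊒ sS S⊑T (bs , bs∈S , li , _) hT v v∈T = do
    yes v∈S ← ¬¬-excluded-middle
      where no v∉S → ⊥-elim (ℕ.n≮n _ (¬¬LinIndep⇒≤dim (v ∷ bs)
                      (¬¬LinIndep-∷ sS bs∈S (LinIndep⇒¬¬LinIndep bs li) v∉S)
                      (pure v∈T ∷ All.map (S⊑T _) bs∈S) hT))
    pure v∈S

  -- S is a hyperplane of T, so T is spanned by S and any h ∈ T ∖ S.
  hyperplane-⊑ : ∀ {h} → IsSubspace S → IsSubspace R → S ⊑ T → HasDim S d → HasDim T (suc d) →
                 T h → ¬ S h → S ⊑ R → ¬ ¬ R h → T ⊑ R
  hyperplane-⊑ sS sR S⊑T (bs , bs∈S , li , _) hT h∈T h∉S S⊑R ¬¬h∈R v v∈T = do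
    bs∈R ← ¬¬-All (All.map (S⊑R _) bs∈S)
    h∈R  ← ¬¬h∈R
    yes v∈R ← ¬¬-excluded-middle
      where no v∉R → ⊥-elim (ℕ.n≮n _ (¬¬LinIndep⇒≤dim (v ∷ _ ∷ bs)
                      (¬¬LinIndep-∷ sR (h∈R ∷ bs∈R) (¬¬LinIndep-∷ sS bs∈S (LinIndep⇒¬¬LinIndep bs li) h∉S) v∉R)
                      (pure v∈T ∷ pure h∈T ∷ All.map (S⊑T _) bs∈S) hT))
    pure v∈R

  excluded-⊑ : (A B : Sub) → ¬ ¬ (A ⊑ B ⊎ ∃ λ v → A v × ¬ B v)
  excluded-⊑ A B = do
    yes witness ← ¬¬-excluded-middle
      where no ∄witness → pure (inj₁ λ v v∈A v∉B → ∄witness (v , v∈A , v∉B))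
    pure (inj₂ witness)

  ⊑-∩-swap : ∀ {W X U k} → IsSubspace W → IsSubspace U → HasDim (W ∩ U) k → HasDim (X ∩ W) k →
             (W ∩ U) ⊑ X → (X ∩ W) ⊑ U
  ⊑-∩-swap {W} {X} {U} sW sU hWU hXW WU⊑X v v∈X∩W = proj₂ <$> ⊑-dim≡⇒⊒ (∩-isSubspace sW sU) WU⊑XW hWU hXW v v∈X∩W
    where
    WU⊑XW : (W ∩ U) ⊑ (X ∩ W)
    WU⊑XW v (v∈W , v∈U) = do
      v∈X ← WU⊑X v (v∈W , v∈U)
      pure (v∈X , v∈W)

module Covers (F : FiniteField) (n : ℕ) (y : Grassmann.P F n) where
  open Grassmann F n
  open Dimension F n
  open Rel (proj₁ y)

  private
    Y = proj₁ y
    sY = proj₂ y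
    variable
      u v : Sub
      k : ℕ

  backCovers⇒⊑ : IsSubspace u → BackCovers v u → (v ∩ Y) ⊑ u
  backCovers⇒⊑ sU (u⊆v , _ , _ , (hU∩Y , _) , (hV∩Y , _)) t t∈V∩Y =
    proj₁ <$> ⊑-dim≡⇒⊒ (∩-isSubspace sU sY) (λ t (t∈U , t∈Y) → pure (u⊆v t t∈U , t∈Y)) hU∩Y hV∩Y t t∈V∩Y

  slashCovers⇒⋢ : SlashCovers v u → ¬ ((v ∩ Y) ⊑ u)
  slashCovers⇒⋢ {v = v} {u = u} (_ , a , _ , (hU∩Y , _) , (hV∩Y , _)) V∩Y⊑U =
    ℕ.n≮n a (dim-mono V∩Y⊑U∩Y hV∩Y hU∩Y)
    where
    V∩Y⊑U∩Y : (v ∩ Y) ⊑ (u ∩ Y)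
    V∩Y⊑U∩Y t (t∈V , t∈Y) = do
      t∈U ← V∩Y⊑U t (t∈V , t∈Y)
      pure (t∈U , t∈Y)

  slashCovers-dim : SlashCovers v u → ∃[ d ] HasDim u d × HasDim v (suc d)
  slashCovers-dim (_ , _ , _ , (_ , hU) , (_ , hV)) = _ , hU , hV

  backCovers-dim : BackCovers v u → ∃[ d ] HasDim u d × HasDim v (suc d)
  backCovers-dim {v = v} (_ , a , b , (_ , hU) , (_ , hV)) = _ , hU , subst (HasDim v) (ℕ.+-suc a b) hV

  slashCovers-dim-pred : SlashCovers v u → HasDim v (suc k) → HasDim u k
  slashCovers-dim-pred {u = u} v/u hV′ =
    let (_ , hU , hV) = slashCovers-dim v/u
    in subst (HasDim u) (ℕ.suc-injective (dim-unique hV hV′)) hU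

module Entries (F : FiniteField) (n : ℕ) (y : Grassmann.P F n) where
  open Grassmann F n
  open Dimension F n
  open Covers F n y
  open Rel (proj₁ y)

  private
    variable
      k : ℕ

  F⁰F⁻-zero : (w x : P) → BackCovers (proj₁ w +ₛ proj₁ x) (proj₁ w) → ProdEntryZero F⁰ F⁻ w x
  F⁰F⁻-zero (W , sW) (X , sX) wx\w (U , sU) (_ , _ , w\wu , _) (_ , x/ux) =
    slashCovers⇒⋢ x/ux λ v (v∈X , v∈Y) → do
      v∈W       ← backCovers⇒⊑ sW wx\w v (+ₛ-inr sW v∈X , v∈Y)
      (_ , v∈U) ← backCovers⇒⊑ (∩-isSubspace sW sU) w\wu v (v∈W , v∈Y)
      pure (v∈U , v∈X)

  F⁻F⁰-zero : (w x : P) → BackCovers (proj₁ w +ₛ proj₁ x) (proj₁ x) → ProdEntryZero F⁻ F⁰ w x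
  F⁻F⁰-zero (W , sW) (X , sX) wx\x (U , sU) (w/wu , _) (_ , _ , _ , x\ux) =
    slashCovers⇒⋢ w/wu λ v (v∈W , v∈Y) → do
      v∈X       ← backCovers⇒⊑ sX wx\x v (+ₛ-inl sX v∈W , v∈Y)
      (v∈U , _) ← backCovers⇒⊑ (∩-isSubspace sU sX) x\ux v (v∈X , v∈Y)
      pure (v∈W , v∈U)

  F⁰F⁺-zero : (w x : P) → SlashCovers (proj₁ w) (proj₁ w ∩ proj₁ x) → ProdEntryZero F⁰ F⁺ w x
  F⁰F⁺-zero (W , sW) (X , sX) w/wx (U , sU) (_ , _ , w\wu , _) (_ , ux\x) =
    slashCovers⇒⋢ w/wx λ v (v∈W , v∈Y) → do
      (_ , v∈U) ← backCovers⇒⊑ (∩-isSubspace sW sU) w\wu v (v∈W , v∈Y)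
      v∈X       ← backCovers⇒⊑ sX ux\x v (+ₛ-inl sX v∈U , v∈Y)
      pure (v∈W , v∈X)

  F⁺F⁰-zero : (w x : P) → SlashCovers (proj₁ w) (proj₁ w ∩ proj₁ x) → ProdEntryZero F⁺ F⁰ w x
  F⁺F⁰-zero (W , sW) (X , sX) w/wx (U , sU) (_ , wu\u) (_ , _ , u\ux , _) =
    slashCovers⇒⋢ w/wx λ v (v∈W , v∈Y) → do
      v∈U       ← backCovers⇒⊑ sU wu\u v (+ₛ-inl sU v∈W , v∈Y)
      (_ , v∈X) ← backCovers⇒⊑ (∩-isSubspace sU sX) u\ux v (v∈U , v∈Y)
      pure (v∈W , v∈X)

  F⁺F⁺-zero : (w x : P) → SlashCovers (proj₁ x) (proj₁ w ∩ proj₁ x) → ProdEntryZero F⁺ F⁺ w x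
  F⁺F⁺-zero (W , sW) (X , sX) x/wx (U , sU) (wu\w , _) (ux\u , _) =
    slashCovers⇒⋢ x/wx λ v (v∈X , v∈Y) → do
      v∈U ← backCovers⇒⊑ sU ux\u v (+ₛ-inr sU v∈X , v∈Y)
      v∈W ← backCovers⇒⊑ sW wu\w v (+ₛ-inr sW v∈U , v∈Y)
      pure (v∈W , v∈X)

  F⁻F⁺-zero : (w x : P) → HasDim (proj₁ x) (suc k) → HasDim (proj₁ w) (suc k) →
              HasDim (proj₁ x ∩ proj₁ w) k → ProdEntryZero F⁻ F⁺ w x
  F⁻F⁺-zero (W , sW) (X , sX) hX hW hX∩W (U , sU) (w/wu , u/wu) (ux\u , ux\x) =
    excluded-⊑ (W ∩ U) X λ where
      (inj₂ (h , (h∈W , h∈U) , h∉X)) → slashCovers⇒⋢ w/wu λ v (v∈W , v∈Y) → do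
        v∈U+X ← W⊑U+X h∈W h∈U h∉X v v∈W
        v∈U   ← backCovers⇒⊑ sU ux\u v (v∈U+X , v∈Y)
        pure (v∈W , v∈U)
      (inj₁ W∩U⊑X) → excluded-⊑ (X ∩ proj₁ y) W λ where
        (inj₁ X∩Y⊑W) → slashCovers⇒⋢ u/wu λ v (v∈U , v∈Y) → do
          v∈X ← backCovers⇒⊑ sX ux\x v (+ₛ-inl sX v∈U , v∈Y)
          v∈W ← X∩Y⊑W v (v∈X , v∈Y)
          pure (v∈W , v∈U)
        (inj₂ (t , (t∈X , t∈Y) , t∉W)) →
          let (d , hU , hU+X) = backCovers-dim ux\u
              X∩W⊑U = ⊑-∩-swap sW sU (slashCovers-dim-pred w/wu hW) hX∩W W∩U⊑X
              X⊑U = hyperplane-⊑ (∩-isSubspace sX sW) sU (λ _ → pure ∘ proj₁) hX∩W hX t∈X (t∉W ∘ proj₂)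
                      X∩W⊑U (backCovers⇒⊑ sU ux\u t (+ₛ-inr sU t∈X , t∈Y))
          in ℕ.n≮n d (dim-mono (+ₛ-least sU (λ _ → pure) X⊑U) hU+X hU)
    where
    W⊑U+X : ∀ {h} → W h → U h → ¬ X h → W ⊑ (U +ₛ X)
    W⊑U+X h∈W h∈U h∉X =
      hyperplane-⊑ (∩-isSubspace sX sW) (+ₛ-isSubspace sU sX) (λ _ → pure ∘ proj₂) hX∩W hW h∈W (h∉X ∘ proj₁)
        (λ _ → pure ∘ +ₛ-inr sU ∘ proj₁) (pure (+ₛ-inl sX h∈U))

  F⁻F⁻-zero : (w x : P) → HasDim (proj₁ w) (suc k) → HasDim (proj₁ x ∩ proj₁ w) k →
              BackCovers (proj₁ w +ₛ proj₁ x) (proj₁ w) → BackCovers (proj₁ w +ₛ proj₁ x) (proj₁ x) →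
              ProdEntryZero F⁻ F⁻ w x
  F⁻F⁻-zero (W , sW) (X , sX) hW hX∩W wx\w wx\x (U , sU) (w/wu , _) (u/ux , x/ux) =
    excluded-⊑ (W ∩ U) X λ where
      (inj₂ (h , (h∈W , h∈U) , h∉X)) → slashCovers⇒⋢ u/ux λ v (v∈U , v∈Y) → do
        v∈W+X ← U⊑W+X h∈W h∈U h∉X v v∈U
        v∈X   ← backCovers⇒⊑ sX wx\x v (v∈W+X , v∈Y)
        pure (v∈U , v∈X)
      (inj₁ W∩U⊑X) → slashCovers⇒⋢ x/ux λ v (v∈X , v∈Y) → do
        v∈W ← backCovers⇒⊑ sW wx\w v (+ₛ-inr sW v∈X , v∈Y)
        v∈U ← ⊑-∩-swap sW sU (slashCovers-dim-pred w/wu hW) hX∩W W∩U⊑X v (v∈X , v∈W)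
        pure (v∈U , v∈X)
    where
    U⊑W+X : ∀ {h} → W h → U h → ¬ X h → U ⊑ (W +ₛ X)
    U⊑W+X h∈W h∈U h∉X =
      let (_ , hU∩X , hU) = slashCovers-dim u/ux
      in hyperplane-⊑ (∩-isSubspace sU sX) (+ₛ-isSubspace sW sX) (λ _ → pure ∘ proj₁) hU∩X hU h∈U (h∉X ∘ proj₂)
           (λ _ → pure ∘ +ₛ-inr sW ∘ proj₂) (pure (+ₛ-inl sX h∈W))

mainTheorem16 : (F : FiniteField) (n k : ℕ) → 2 * k < n → 6 ≤ 2 * k →
    let open Grassmann F n in
    let open Graph k in
    (x y : P) → IsVertex x → IsVertex y →
    Σ ℕ (λ d → Dist x y d × 1 < d × d < k) →
    let open Rel (proj₁ y) in
    (w : P) → 𝒜 x y w →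
      ProdEntryZero F⁻ F⁺ w x
      × (𝒜⁺ x y w → ProdEntryZero F⁰ F⁻ w x)
      × (𝒜⁺ x y w → ProdEntryZero F⁻ F⁰ w x)
      × (𝒜⁺ x y w → ProdEntryZero F⁻ F⁻ w x)
      × (𝒜⁻ x y w → ProdEntryZero F⁰ F⁺ w x)
      × (𝒜⁻ x y w → ProdEntryZero F⁺ F⁰ w x)
      × (𝒜⁻ x y w → ProdEntryZero F⁺ F⁺ w x)
mainTheorem16 F n zero    _ ()
mainTheorem16 F n (suc k) _ _ x y x-dim _ _ w ((w-dim , x∩w-dim) , _) =
    F⁻F⁺-zero w x x-dim w-dim x∩w-dim
  , (λ (_ , wx\w , _)    → F⁰F⁻-zero w x wx\w)
  , (λ (_ , _ , wx\x)    → F⁻F⁰-zero w x wx\x)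
  , (λ (_ , wx\w , wx\x) → F⁻F⁻-zero w x w-dim x∩w-dim wx\w wx\x)
  , (λ (_ , w/wx , _)    → F⁰F⁺-zero w x w/wx)
  , (λ (_ , w/wx , _)    → F⁺F⁰-zero w x w/wx)
  , (λ (_ , _ , x/wx)    → F⁺F⁺-zero w x x/wx)
  where open Entries F n y
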